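{- Let $n$ be a positive integer. Then: (1) $\displaystyle\sum_{j=0}^{n}(-1)^{j}{n \brack j}{n+j \brack j}\frac{q^{\binom{j+1}{2}-jn}}{1-xq^{j}}=\frac{x^{n}(q/x;q)_{n}}{(x;q)_{n+1}}$; (2) for $l=1,2,\ldots,n$: $\displaystyle\sum_{j=0}^{n}(-1)^{j}{n \brack j}{n+j \brack j}\frac{q^{\binom{j+1}{2}-jn}}{1-q^{j+l}}=0$; (3) for $l=1,2,\ldots,n$: $\displaystyle\sum_{j=0}^{n-1}(-1)^{n+1+j}{n \brack j}{n+j \brack j}\frac{1-q^{n+l}}{1-q^{j+l}}q^{\binom{j+1}{2}+n^{2}-jn}={2n \brack n}q^{\binom{n+1}{2}}$; (4) $\displaystyle q^{\binom{n+1}{2}}=\sum_{j=0}^{n}(-1)^{n-j}{n \brack j}{n+j \brack j}q^{\binom{j+1}{2}-jn}$.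
   Context: $q$ is an indeterminate (or a nonzero complex number, not a root of unity). $(x;q)_{0}=1$, $(x;q)_{n}=\prod_{t=0}^{n-1}(1-q^{t}x)$; ${n \brack j}=\frac{(q;q)_{n}}{(q;q)_{j}(q;q)_{n-j}}$. In (1), $x$ is an indeterminate and $x^{n}(q/x;q)_{n}=\prod_{t=1}^{n}(x-q^{t})$. -}

module Defs where

open import Level using (Level; _⊔_) renaming (suc to lsuc)
open import Data.Nat using (ℕ; zero; suc; _∸_)
open import Data.Product using (_×_)
open import Relation.Nullary using (¬_)
open import Algebra.Bundles using (CommutativeRing)

record Field (c ℓ : Level) : Set (lsuc (c ⊔ ℓ)) where
  field
    commutativeRing : CommutativeRing c ℓ
  open CommutativeRing commutativeRing public
  field
    _⁻¹      : Carrier → Carrier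
    ⁻¹-cong  : ∀ {x y} → x ≈ y → (x ⁻¹) ≈ (y ⁻¹)
    inverseʳ : ∀ {x} → ¬ (x ≈ 0#) → (x * (x ⁻¹)) ≈ 1#
    0≉1      : ¬ (0# ≈ 1#)
  infix 8 _⁻¹

module FieldOps {c ℓ : Level} (F : Field c ℓ) where
  open Field F

  _^_ : Carrier → ℕ → Carrier
  x ^ zero  = 1#
  x ^ suc k = x * (x ^ k)
  infixr 9 _^_

  _÷_ : Carrier → Carrier → Carrier
  a ÷ b = a * (b ⁻¹)
  infixl 7 _÷_

  fromℕ : ℕ → Carrier
  fromℕ zero    = 0#
  fromℕ (suc m) = 1# + fromℕ m

  Σ< : ℕ → (ℕ → Carrier) → Carrier
  Σ< zero    f = 0#
  Σ< (suc n) f = Σ< n f + f n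

  Π< : ℕ → (ℕ → Carrier) → Carrier
  Π< zero    f = 1#
  Π< (suc n) f = Π< n f * f n

  sgn : ℕ → Carrier
  sgn j = (- 1#) ^ j

  CharZero : Set ℓ
  CharZero = ∀ m → ¬ (fromℕ (suc m) ≈ 0#)

  NotRootOfUnity : Carrier → Set ℓ
  NotRootOfUnity q = ¬ (q ≈ 0#) × (∀ m → ¬ ((q ^ suc m) ≈ 1#))

module QSeries {c ℓ : Level} (F : Field c ℓ) (q : Field.Carrier F) where
  open Field F
  open FieldOps F

  qPoch : Carrier → ℕ → Carrier
  qPoch x n = Π< n (λ t → 1# - (q ^ t) * x)

  -- q-binomial [n choose j] = (q;q)_n / ((q;q)_j (q;q)_{n-j})   (used for j ≤ n)
  qbinom : ℕ → ℕ → Carrier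
  qbinom n j = qPoch q n ÷ (qPoch q j * qPoch q (n ∸ j))

  -- x^n (q/x;q)_n, written as ∏_{t=1}^{n} (x - q^t) as in the context
  xnPoch : Carrier → ℕ → Carrier
  xnPoch x n = Π< n (λ t → x - q ^ suc t)

-- Write S n x for the left side of (1) and R n x for its right side. Then
-- R (n+1) x = R n x · (x − q^(n+1)) / (1 − x q^(n+1)). Multiplying the j-th term of
-- S n x by this factor and splitting (x − q^(n+1)) / ((1 − x q^(n+1)) (1 − x q^j)) into
-- partial fractions gives the j-th term of S (n+1) x plus a multiple of 1 / (1 − x q^(n+1))
-- whose numerator, summed over j, is (q^(−n−1) − q^(n+1)) · S n (q^(−n−1)). By induction on
-- n, applied both at x and at q^(−n−1), that numerator is (q^(−n−1) − q^(n+1)) · R n (q^(−n−1)),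
-- and evaluating R n at q^(−n−1) explicitly shows that the leftover is exactly the last term
-- of S (n+1) x. Identity (2) is (1) at x = q^l, a root of the numerator of R n; (3) is (2)
-- with the j = n term moved across and rescaled; (4) is (1) at x = 0.
module Submission where

open import Defs
open import Level using (Level)
open import Data.Nat using (ℕ; suc; _∸_; _≤_) renaming (_+_ to _+ℕ_; _*_ to _*ℕ_)
open import Data.Nat.Combinatorics using (_C_)
open import Data.Product using (_×_)
open import Relation.Nullary using (¬_)

open import Algebra.Bundles using (CommutativeRing)
import Algebra.Solver.Ring
import Algebra.Solver.Ring.AlmostCommutativeRing as ACR
open import Data.Integer as ℤ using (ℤ; +_; -[1+_])
import Data.Integer.Properties as ℤ
open import Data.Maybe using (Maybe; just; nothing)
open import Data.Nat as ℕ using (zero; z≤n; s≤s; _<_)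
import Data.Nat.Combinatorics as ℕ
import Data.Nat.Properties as ℕ
open import Data.Product using (_,_; proj₁; proj₂)
open import Data.Sign as Sign using (Sign)
open import Data.Sum using (inj₁; inj₂)
open import Relation.Binary.PropositionalEquality as ≡ using (_≡_)
open import Relation.Nullary using (yes; no)
open import Function using (_∘_)

-- The standard library's ring solvers need either a decidable equality on the carrier or
-- natural-number coefficients (which cannot cancel x − x), so we supply integer coefficients.
module IntegerCoefficientSolver {c ℓ} (R : CommutativeRing c ℓ) where
  open CommutativeRing R hiding (zero)
  open import Algebra.Properties.Semiring.Mult.TCOptimised semiring using (×-homo-+; ×1-homo-*) renaming (_×_ to _·_)
  open import Algebra.Properties.Ring ring
    using (-0#≈0#; -‿involutive; -‿+-comm; -‿distribˡ-*; xyx⁻¹≈y)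
  open import Relation.Binary.Reasoning.Setoid setoid

  -- The optimised _·_ makes ⟦ + 1 ⟧ reduce to 1#, so solver constants match goals literally.
  ⟦_⟧ : ℤ → Carrier
  ⟦ + n ⟧     = n · 1#
  ⟦ -[1+ n ] ⟧ = - (suc n · 1#)

  ⊖-homo : ∀ m n → ⟦ m ℤ.⊖ n ⟧ ≈ m · 1# - n · 1#
  ⊖-homo m zero = begin
    m · 1#       ≈⟨ +-identityʳ _ ⟨
    m · 1# + 0#  ≈⟨ +-congˡ -0#≈0# ⟨
    m · 1# - 0#  ∎
  ⊖-homo zero    (suc n) = sym (+-identityˡ _)
  ⊖-homo (suc m) (suc n) = begin
    ⟦ suc m ℤ.⊖ suc n ⟧                ≡⟨ ≡.cong ⟦_⟧ (ℤ.[1+m]⊖[1+n]≡m⊖n m n) ⟩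
    ⟦ m ℤ.⊖ n ⟧                        ≈⟨ ⊖-homo m n ⟩
    a - b                              ≈⟨ +-congʳ (xyx⁻¹≈y 1# a) ⟨
    (1# + a - 1#) - b                  ≈⟨ +-assoc _ _ _ ⟩
    (1# + a) + (- 1# - b)              ≈⟨ +-congˡ (-‿+-comm 1# b) ⟩
    (1# + a) - (1# + b)                ≈⟨ +-cong (×-homo-+ 1# 1 m) (-‿cong (×-homo-+ 1# 1 n)) ⟨
    suc m · 1# - suc n · 1#            ∎
    where
      a b : Carrier
      a = m · 1#
      b = n · 1#

  +-homo : ∀ i j → ⟦ i ℤ.+ j ⟧ ≈ ⟦ i ⟧ + ⟦ j ⟧
  +-homo -[1+ m ] -[1+ n ] = begin
    - (suc (suc (m ℕ.+ n)) · 1#)       ≡⟨ ≡.cong (λ k → - (suc k · 1#)) (ℕ.+-suc m n) ⟨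
    - ((suc m ℕ.+ suc n) · 1#)         ≈⟨ -‿cong (×-homo-+ 1# (suc m) (suc n)) ⟩
    - (suc m · 1# + suc n · 1#)        ≈⟨ -‿+-comm _ _ ⟨
    - (suc m · 1#) - (suc n · 1#)      ∎
  +-homo -[1+ m ] (+ n)    = trans (⊖-homo n (suc m)) (+-comm _ _)
  +-homo (+ m)    -[1+ n ] = ⊖-homo m (suc n)
  +-homo (+ m)    (+ n)    = ×-homo-+ 1# m n

  neg-homo : ∀ i → ⟦ ℤ.- i ⟧ ≈ - ⟦ i ⟧
  neg-homo -[1+ n ]    = sym (-‿involutive _)
  neg-homo (+ zero)    = sym -0#≈0#
  neg-homo (+ suc n)   = refl

  sign : Sign → Carrier
  sign Sign.+ = 1#
  sign Sign.- = - 1#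

  sign-homo : ∀ s t → sign (s Sign.* t) ≈ sign s * sign t
  sign-homo Sign.- Sign.- = begin
    1#            ≈⟨ -‿involutive 1# ⟨
    - - 1#        ≈⟨ -‿cong (*-identityˡ _) ⟨
    - (1# * - 1#) ≈⟨ -‿distribˡ-* 1# (- 1#) ⟩
    - 1# * - 1#   ∎
  sign-homo Sign.- Sign.+ = sym (*-identityʳ _)
  sign-homo Sign.+ t      = sym (*-identityˡ _)

  ◃-homo : ∀ s n → ⟦ s ℤ.◃ n ⟧ ≈ sign s * (n · 1#)
  ◃-homo s      zero    = sym (zeroʳ _)
  ◃-homo Sign.+ (suc n) = sym (*-identityˡ _)
  ◃-homo Sign.- (suc n) = trans (-‿cong (sym (*-identityˡ _))) (-‿distribˡ-* 1# _)

  sign-abs : ∀ i → ⟦ i ⟧ ≈ sign (ℤ.sign i) * (ℤ.∣ i ∣ · 1#)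
  sign-abs -[1+ n ] = ◃-homo Sign.- (suc n)
  sign-abs (+ n)    = sym (*-identityˡ _)

  *-homo : ∀ i j → ⟦ i ℤ.* j ⟧ ≈ ⟦ i ⟧ * ⟦ j ⟧
  *-homo i j = begin
    ⟦ i ℤ.* j ⟧                                   ≈⟨ ◃-homo (ℤ.sign i Sign.* ℤ.sign j) (ℤ.∣ i ∣ ℕ.* ℤ.∣ j ∣) ⟩
    sign (ℤ.sign i Sign.* ℤ.sign j) * ((ℤ.∣ i ∣ ℕ.* ℤ.∣ j ∣) · 1#)
                                                  ≈⟨ *-cong (sign-homo (ℤ.sign i) (ℤ.sign j)) (×1-homo-* ℤ.∣ i ∣ ℤ.∣ j ∣) ⟩
    (s * t) * (m * n)                             ≈⟨ *-assoc _ _ _ ⟩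
    s * (t * (m * n))                             ≈⟨ *-congˡ (x∙yz≈y∙xz t m n) ⟩
    s * (m * (t * n))                             ≈⟨ *-assoc _ _ _ ⟨
    (s * m) * (t * n)                             ≈⟨ *-cong (sign-abs i) (sign-abs j) ⟨
    ⟦ i ⟧ * ⟦ j ⟧                                 ∎
    where
      open import Algebra.Properties.CommutativeSemigroup *-commutativeSemigroup using (x∙yz≈y∙xz)
      s t m n : Carrier
      s = sign (ℤ.sign i)
      t = sign (ℤ.sign j)
      m = ℤ.∣ i ∣ · 1#
      n = ℤ.∣ j ∣ · 1#

  homomorphism : ℤ.+-*-rawRing ACR.-Raw-AlmostCommutative⟶ ACR.fromCommutativeRing R
  homomorphism = record
    { ⟦_⟧    = ⟦_⟧
    ; +-homo = +-homo
    ; *-homo = *-homo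
    ; -‿homo = neg-homo
    ; 0-homo = refl
    ; 1-homo = refl
    }

  _≟-coeff_ : ∀ i j → Maybe (⟦ i ⟧ ≈ ⟦ j ⟧)
  i ≟-coeff j with i ℤ.≟ j
  ... | yes ≡.refl = just refl
  ... | no _       = nothing

  open Algebra.Solver.Ring ℤ.+-*-rawRing (ACR.fromCommutativeRing R) homomorphism _≟-coeff_ public
    using (Polynomial; con; solve; _:+_; _:*_; :-_; _:-_; _:=_)

  :0 :1 : ∀ {n} → Polynomial n
  :0 = con (+ 0)
  :1 = con (+ 1)

module FieldProperties {c ℓ} (F : Field c ℓ) where
  open Field F
  open FieldOps F
  open IntegerCoefficientSolver commutativeRing
  open import Relation.Binary.Reasoning.Setoid setoid

  1≉0 : ¬ 1# ≈ 0#
  1≉0 1≈0 = 0≉1 (sym 1≈0)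

  inverseˡ : ∀ {x} → ¬ x ≈ 0# → x ⁻¹ * x ≈ 1#
  inverseˡ x≉0 = trans (*-comm _ _) (inverseʳ x≉0)

  *-cancelʳ : ∀ {x y z} → ¬ z ≈ 0# → x * z ≈ y * z → x ≈ y
  *-cancelʳ {x} {y} {z} z≉0 xz≈yz = begin
    x                 ≈⟨ *-identityʳ x ⟨
    x * 1#            ≈⟨ *-congˡ (inverseʳ z≉0) ⟨
    x * (z * z ⁻¹)    ≈⟨ *-assoc _ _ _ ⟨
    (x * z) * z ⁻¹    ≈⟨ *-congʳ xz≈yz ⟩
    (y * z) * z ⁻¹    ≈⟨ *-assoc _ _ _ ⟩
    y * (z * z ⁻¹)    ≈⟨ *-congˡ (inverseʳ z≉0) ⟩
    y * 1#            ≈⟨ *-identityʳ y ⟩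
    y                 ∎

  x*y≉0 : ∀ {x y} → ¬ x ≈ 0# → ¬ y ≈ 0# → ¬ x * y ≈ 0#
  x*y≉0 {x} {y} x≉0 y≉0 xy≈0 = y≉0 (*-cancelʳ x≉0 (begin
    y * x    ≈⟨ *-comm y x ⟩
    x * y    ≈⟨ xy≈0 ⟩
    0#       ≈⟨ zeroˡ x ⟨
    0# * x   ∎))

  x*y≈1⇒x≉0 : ∀ {x y} → x * y ≈ 1# → ¬ x ≈ 0#
  x*y≈1⇒x≉0 {x} {y} xy≈1 x≈0 = 1≉0 (begin
    1#       ≈⟨ xy≈1 ⟨
    x * y    ≈⟨ *-congʳ x≈0 ⟩
    0# * y   ≈⟨ zeroˡ y ⟩
    0#       ∎)

  x÷y*y≈x : ∀ {x y} → ¬ y ≈ 0# → x ÷ y * y ≈ x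
  x÷y*y≈x {x} {y} y≉0 = begin
    x * y ⁻¹ * y     ≈⟨ *-assoc _ _ _ ⟩
    x * (y ⁻¹ * y)   ≈⟨ *-congˡ (inverseˡ y≉0) ⟩
    x * 1#           ≈⟨ *-identityʳ x ⟩
    x                ∎

  x≈z÷y : ∀ {x y z} → ¬ y ≈ 0# → x * y ≈ z → x ≈ z ÷ y
  x≈z÷y {x} {y} {z} y≉0 xy≈z = *-cancelʳ y≉0 (trans xy≈z (sym (x÷y*y≈x y≉0)))

  ⁻¹-unique : ∀ {x y} → x * y ≈ 1# → x ⁻¹ ≈ y
  ⁻¹-unique {x} {y} xy≈1 = sym (trans (x≈z÷y (x*y≈1⇒x≉0 xy≈1) (trans (*-comm y x) xy≈1)) (*-identityˡ _))

  1⁻¹≈1 : 1# ⁻¹ ≈ 1#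
  1⁻¹≈1 = ⁻¹-unique (*-identityˡ 1#)

  ⁻¹-distrib-* : ∀ {x y} → ¬ x ≈ 0# → ¬ y ≈ 0# → (x * y) ⁻¹ ≈ x ⁻¹ * y ⁻¹
  ⁻¹-distrib-* {x} {y} x≉0 y≉0 = ⁻¹-unique (begin
    (x * y) * (x ⁻¹ * y ⁻¹)    ≈⟨ solve 4 (λ x y x' y' → (x :* y) :* (x' :* y') := (x :* x') :* (y :* y')) refl x y (x ⁻¹) (y ⁻¹) ⟩
    (x * x ⁻¹) * (y * y ⁻¹)    ≈⟨ *-cong (inverseʳ x≉0) (inverseʳ y≉0) ⟩
    1# * 1#                    ≈⟨ *-identityˡ 1# ⟩
    1#                         ∎)

  ^-congˡ : ∀ {x y} n → x ≈ y → x ^ n ≈ y ^ n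
  ^-congˡ zero    x≈y = refl
  ^-congˡ (suc n) x≈y = *-cong x≈y (^-congˡ n x≈y)

  ^-homo-* : ∀ x m n → x ^ (m +ℕ n) ≈ x ^ m * x ^ n
  ^-homo-* x zero    n = sym (*-identityˡ _)
  ^-homo-* x (suc m) n = trans (*-congˡ (^-homo-* x m n)) (sym (*-assoc _ _ _))

  ^-distrib-* : ∀ x y n → (x * y) ^ n ≈ x ^ n * y ^ n
  ^-distrib-* x y zero    = sym (*-identityˡ 1#)
  ^-distrib-* x y (suc n) = trans (*-congˡ (^-distrib-* x y n))
    (solve 4 (λ x y a b → (x :* y) :* (a :* b) := (x :* a) :* (y :* b)) refl x y (x ^ n) (y ^ n))

  ^-assocʳ : ∀ x m n → (x ^ m) ^ n ≈ x ^ (m *ℕ n)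
  ^-assocʳ x m zero    = reflexive (≡.cong (x ^_) (≡.sym (ℕ.*-zeroʳ m)))
  ^-assocʳ x m (suc n) = begin
    x ^ m * (x ^ m) ^ n       ≈⟨ *-congˡ (^-assocʳ x m n) ⟩
    x ^ m * x ^ (m *ℕ n)      ≈⟨ ^-homo-* x m (m *ℕ n) ⟨
    x ^ (m +ℕ m *ℕ n)         ≡⟨ ≡.cong (x ^_) (ℕ.*-suc m n) ⟨
    x ^ (m *ℕ suc n)          ∎

  1^n≈1 : ∀ n → 1# ^ n ≈ 1#
  1^n≈1 zero    = refl
  1^n≈1 (suc n) = trans (*-identityˡ _) (1^n≈1 n)

  x*y≈1⇒x^n*y^n≈1 : ∀ {x y} n → x * y ≈ 1# → x ^ n * y ^ n ≈ 1#
  x*y≈1⇒x^n*y^n≈1 {x} {y} n xy≈1 = trans (sym (^-distrib-* x y n)) (trans (^-congˡ n xy≈1) (1^n≈1 n))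

  sgn-+ : ∀ m n → sgn (m +ℕ n) ≈ sgn m * sgn n
  sgn-+ = ^-homo-* (- 1#)

  sgn*sgn≈1 : ∀ n → sgn n * sgn n ≈ 1#
  sgn*sgn≈1 n = x*y≈1⇒x^n*y^n≈1 n (solve 0 ((:- :1) :* (:- :1) := :1) refl)

  sgn-∸ : ∀ {n j} → j ≤ n → sgn (n ∸ j) ≈ sgn n * sgn j
  sgn-∸ {n} {j} j≤n = sym (begin
    sgn n * sgn j                          ≡⟨ ≡.cong (λ i → sgn i * sgn j) (ℕ.m∸n+n≡m j≤n) ⟨
    sgn (n ∸ j +ℕ j) * sgn j               ≈⟨ *-congʳ (sgn-+ (n ∸ j) j) ⟩
    sgn (n ∸ j) * sgn j * sgn j            ≈⟨ *-assoc _ _ _ ⟩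
    sgn (n ∸ j) * (sgn j * sgn j)          ≈⟨ *-congˡ (sgn*sgn≈1 j) ⟩
    sgn (n ∸ j) * 1#                       ≈⟨ *-identityʳ _ ⟩
    sgn (n ∸ j)                            ∎)

  Σ<-cong : ∀ k {f g : ℕ → Carrier} → (∀ j → j < k → f j ≈ g j) → Σ< k f ≈ Σ< k g
  Σ<-cong zero    f≈g = refl
  Σ<-cong (suc k) f≈g = +-cong (Σ<-cong k (λ j j<k → f≈g j (ℕ.m<n⇒m<1+n j<k))) (f≈g k (ℕ.n<1+n k))

  Σ<-*ˡ : ∀ k a (f : ℕ → Carrier) → Σ< k (λ j → a * f j) ≈ a * Σ< k f
  Σ<-*ˡ zero    a f = sym (zeroʳ a)
  Σ<-*ˡ (suc k) a f = trans (+-congʳ (Σ<-*ˡ k a f)) (sym (distribˡ a _ _))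

  Σ<-*ʳ : ∀ k a (f : ℕ → Carrier) → Σ< k (λ j → f j * a) ≈ Σ< k f * a
  Σ<-*ʳ zero    a f = sym (zeroˡ a)
  Σ<-*ʳ (suc k) a f = trans (+-congʳ (Σ<-*ʳ k a f)) (sym (distribʳ a _ _))

  Σ<-+ : ∀ k (f g : ℕ → Carrier) → Σ< k (λ j → f j + g j) ≈ Σ< k f + Σ< k g
  Σ<-+ zero    f g = sym (+-identityˡ 0#)
  Σ<-+ (suc k) f g = trans (+-congʳ (Σ<-+ k f g))
    (solve 4 (λ a b c d → (a :+ b) :+ (c :+ d) := (a :+ c) :+ (b :+ d)) refl (Σ< k f) (Σ< k g) (f k) (g k))

  Π<-cong : ∀ k {f g : ℕ → Carrier} → (∀ j → j < k → f j ≈ g j) → Π< k f ≈ Π< k g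
  Π<-cong zero    f≈g = refl
  Π<-cong (suc k) f≈g = *-cong (Π<-cong k (λ j j<k → f≈g j (ℕ.m<n⇒m<1+n j<k))) (f≈g k (ℕ.n<1+n k))

  Π<≉0 : ∀ k (f : ℕ → Carrier) → (∀ j → j < k → ¬ f j ≈ 0#) → ¬ Π< k f ≈ 0#
  Π<≉0 zero    f f≉0 = 1≉0
  Π<≉0 (suc k) f f≉0 = x*y≉0 (Π<≉0 k f (λ j j<k → f≉0 j (ℕ.m<n⇒m<1+n j<k))) (f≉0 k (ℕ.n<1+n k))

  Π<≈0 : ∀ k (f : ℕ → Carrier) t → t < k → f t ≈ 0# → Π< k f ≈ 0#
  Π<≈0 (suc k) f t t<1+k ft≈0 with ℕ.m<1+n⇒m<n∨m≡n t<1+k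
  ... | inj₁ t<k    = trans (*-congʳ (Π<≈0 k f t t<k ft≈0)) (zeroˡ _)
  ... | inj₂ ≡.refl = trans (*-congˡ ft≈0) (zeroʳ _)

  Π<≈1 : ∀ k (f : ℕ → Carrier) → (∀ j → j < k → f j ≈ 1#) → Π< k f ≈ 1#
  Π<≈1 zero    f f≈1 = refl
  Π<≈1 (suc k) f f≈1 = trans (*-cong (Π<≈1 k f (λ j j<k → f≈1 j (ℕ.m<n⇒m<1+n j<k))) (f≈1 k (ℕ.n<1+n k))) (*-identityˡ 1#)

  Π<-suc : ∀ k (f : ℕ → Carrier) → Π< (suc k) f ≈ f 0 * Π< k (λ t → f (suc t))
  Π<-suc zero    f = trans (*-identityˡ _) (sym (*-identityʳ _))
  Π<-suc (suc k) f = trans (*-congʳ (Π<-suc k f)) (*-assoc _ _ _)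

  partialFraction : ∀ {u v d} → (u - v) * d ≈ 1# → ∀ x →
    x - v ≈ (1# - v * u) * d * (1# - x * v) + (v * v - 1#) * d * (1# - x * u)
  partialFraction {u} {v} {d} [u-v]d≈1 x = begin
    x - v                     ≈⟨ *-identityʳ _ ⟨
    (x - v) * 1#              ≈⟨ *-congˡ [u-v]d≈1 ⟨
    (x - v) * ((u - v) * d)   ≈⟨ solve 4 (λ u v d x → (x :- v) :* ((u :- v) :* d)
                                   := (:1 :- v :* u) :* d :* (:1 :- x :* v) :+ (v :* v :- :1) :* d :* (:1 :- x :* u))
                                   refl u v d x ⟩
    (1# - v * u) * d * (1# - x * v) + (v * v - 1#) * d * (1# - x * u) ∎

  partialFraction-residue : ∀ {u v d a} → (u - v) * d ≈ 1# → a * v ≈ 1# →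
    (v * v - 1#) * d * (1# - a * u) ≈ a - v
  partialFraction-residue {u} {v} {d} {a} [u-v]d≈1 av≈1 = begin
    (v * v - 1#) * d * (1# - a * u)      ≈⟨ *-congˡ (+-congʳ av≈1) ⟨
    (v * v - 1#) * d * (a * v - a * u)   ≈⟨ solve 4 (λ u v d a → (v :* v :- :1) :* d :* (a :* v :- a :* u)
                                              := a :* (:1 :- v :* v) :* ((u :- v) :* d)) refl u v d a ⟩
    a * (1# - v * v) * ((u - v) * d)     ≈⟨ *-congˡ [u-v]d≈1 ⟩
    a * (1# - v * v) * 1#                ≈⟨ solve 2 (λ v a → a :* (:1 :- v :* v) :* :1 := a :- (a :* v) :* v) refl v a ⟩
    a - (a * v) * v                      ≈⟨ +-congˡ (-‿cong (*-congʳ av≈1)) ⟩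
    a - 1# * v                           ≈⟨ +-congˡ (-‿cong (*-identityˡ v)) ⟩
    a - v                                ∎

  ÷-split : ∀ {N A B Du Dv} c → ¬ Du ≈ 0# → ¬ Dv ≈ 0# → N ≈ A * Dv + B * Du →
    (N ÷ Dv) * (c ÷ Du) ≈ (c * A) ÷ Du + (c * B) ÷ Dv
  ÷-split {N} {A} {B} {Du} {Dv} c Du≉0 Dv≉0 N≈ = begin
    (N ÷ Dv) * (c ÷ Du)                       ≈⟨ *-congʳ (*-congʳ N≈) ⟩
    ((A * Dv + B * Du) ÷ Dv) * (c ÷ Du)       ≈⟨ solve 7 (λ A B Du Dv Du' Dv' c →
                                                   ((A :* Dv :+ B :* Du) :* Dv') :* (c :* Du')
                                                   := (c :* A) :* Du' :* (Dv :* Dv') :+ (c :* B) :* Dv' :* (Du :* Du'))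
                                                   refl A B Du Dv (Du ⁻¹) (Dv ⁻¹) c ⟩
    (c * A) ÷ Du * (Dv * Dv ⁻¹) + (c * B) ÷ Dv * (Du * Du ⁻¹)
                                              ≈⟨ +-cong (*-congˡ (inverseʳ Dv≉0)) (*-congˡ (inverseʳ Du≉0)) ⟩
    (c * A) ÷ Du * 1# + (c * B) ÷ Dv * 1#     ≈⟨ +-cong (*-identityʳ _) (*-identityʳ _) ⟩
    (c * A) ÷ Du + (c * B) ÷ Dv               ∎

[2+k]C2≡1+k+[1+k]C2 : ∀ k → suc (suc k) C 2 ≡ suc k +ℕ suc k C 2
[2+k]C2≡1+k+[1+k]C2 k = ≡.trans (≡.sym (ℕ.nCk+nC[k+1]≡[n+1]C[k+1] (suc k) 1)) (≡.cong (_+ℕ suc k C 2) (ℕ.nC1≡n (suc k)))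

module QPartialFractions {c ℓ} (F : Field c ℓ) (q : Field.Carrier F)
                         (q-generic : FieldOps.NotRootOfUnity F q) where
  open Field F
  open FieldOps F
  open QSeries F q
  open FieldProperties F
  open IntegerCoefficientSolver commutativeRing
  open import Relation.Binary.Reasoning.Setoid setoid
  open import Algebra.Properties.Ring ring using (x∙y⁻¹≈ε⇒x≈y)
  open import Algebra.Properties.CommutativeSemigroup *-commutativeSemigroup using (x∙yz≈y∙xz)

  q⁻¹ : Carrier
  q⁻¹ = q ⁻¹

  q*q⁻¹≈1 : q * q⁻¹ ≈ 1#
  q*q⁻¹≈1 = inverseʳ (proj₁ q-generic)

  q^n*q⁻¹^n≈1 : ∀ n → q ^ n * q⁻¹ ^ n ≈ 1#
  q^n*q⁻¹^n≈1 n = x*y≈1⇒x^n*y^n≈1 n q*q⁻¹≈1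

  q⁻¹^n*q^n≈1 : ∀ n → q⁻¹ ^ n * q ^ n ≈ 1#
  q⁻¹^n*q^n≈1 n = trans (*-comm _ _) (q^n*q⁻¹^n≈1 n)

  1-q^[1+k]≉0 : ∀ k → ¬ 1# - q ^ suc k ≈ 0#
  1-q^[1+k]≉0 k 1-q^[1+k]≈0 = proj₂ q-generic k (sym (x∙y⁻¹≈ε⇒x≈y 1# _ 1-q^[1+k]≈0))

  1-q⁻¹^[1+k]≉0 : ∀ k → ¬ 1# - q⁻¹ ^ suc k ≈ 0#
  1-q⁻¹^[1+k]≉0 k 1-q⁻¹^[1+k]≈0 = proj₂ q-generic k (begin
    q ^ suc k                    ≈⟨ *-identityʳ _ ⟨
    q ^ suc k * 1#               ≈⟨ *-congˡ (x∙y⁻¹≈ε⇒x≈y 1# _ 1-q⁻¹^[1+k]≈0) ⟩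
    q ^ suc k * q⁻¹ ^ suc k      ≈⟨ q^n*q⁻¹^n≈1 (suc k) ⟩
    1#                           ∎)

  -- qPoch q (suc k) unfolds to qPoch q k * qFactor k.
  qFactor : ℕ → Carrier
  qFactor k = 1# - q ^ k * q

  qFactor≉0 : ∀ k → ¬ qFactor k ≈ 0#
  qFactor≉0 k = 1-q^[1+k]≉0 k ∘ trans (+-congˡ (-‿cong (*-comm q (q ^ k))))

  qPoch-q≉0 : ∀ k → ¬ qPoch q k ≈ 0#
  qPoch-q≉0 k = Π<≉0 k _ (λ j _ → qFactor≉0 j)

  qbinom-denominator≉0 : ∀ n j → ¬ qPoch q j * qPoch q (n ∸ j) ≈ 0#
  qbinom-denominator≉0 n j = x*y≉0 (qPoch-q≉0 j) (qPoch-q≉0 (n ∸ j))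

  qbinom-*-denominator : ∀ n j → qbinom n j * (qPoch q j * qPoch q (n ∸ j)) ≈ qPoch q n
  qbinom-*-denominator n j = x÷y*y≈x (qbinom-denominator≉0 n j)

  qbinom-diag : ∀ n → qbinom n n ≈ 1#
  qbinom-diag n = begin
    qPoch q n ÷ (qPoch q n * qPoch q (n ∸ n))   ≡⟨ ≡.cong (λ k → qPoch q n ÷ (qPoch q n * qPoch q k)) (ℕ.n∸n≡0 n) ⟩
    qPoch q n ÷ (qPoch q n * 1#)                ≈⟨ x≈z÷y (x*y≉0 (qPoch-q≉0 n) 1≉0) (trans (*-identityˡ _) (*-identityʳ _)) ⟨
    1#                                          ∎

  qbinom-suc : ∀ {m j} → j ≤ m → qbinom (suc m) j ≈ qbinom m j * (qFactor m ÷ qFactor (m ∸ j))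
  qbinom-suc {m} {j} j≤m = sym (x≈z÷y (qbinom-denominator≉0 (suc m) j) (begin
    B * (gm * gk ⁻¹) * (qPoch q j * qPoch q (suc m ∸ j))
      ≡⟨ ≡.cong (λ i → B * (gm * gk ⁻¹) * (qPoch q j * qPoch q i)) (ℕ.+-∸-assoc 1 j≤m) ⟩
    B * (gm * gk ⁻¹) * (qPoch q j * (qPoch q k * gk))
      ≈⟨ solve 6 (λ B gm gk gk⁻¹ Pj Pk → B :* (gm :* gk⁻¹) :* (Pj :* (Pk :* gk))
                                          := (B :* (Pj :* Pk)) :* gm :* (gk⁻¹ :* gk))
                 refl B gm gk (gk ⁻¹) (qPoch q j) (qPoch q k) ⟩
    (B * (qPoch q j * qPoch q k)) * gm * (gk ⁻¹ * gk)
      ≈⟨ *-cong (*-congʳ (qbinom-*-denominator m j)) (inverseˡ (qFactor≉0 k)) ⟩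
    qPoch q m * gm * 1#
      ≈⟨ *-identityʳ _ ⟩
    qPoch q (suc m) ∎))
    where
      k : ℕ
      k = m ∸ j
      B gm gk : Carrier
      B = qbinom m j
      gm = qFactor m
      gk = qFactor k

  weight : ℕ → ℕ → Carrier
  weight n j = q ^ (suc j C 2) * q⁻¹ ^ (j *ℕ n)

  coeff : ℕ → ℕ → Carrier
  coeff n j = sgn j * qbinom n j * qbinom (n +ℕ j) j * weight n j

  weight-suc : ∀ n j → weight (suc n) j ≈ weight n j * q⁻¹ ^ j
  weight-suc n j = begin
    q ^ (suc j C 2) * q⁻¹ ^ (j *ℕ suc n)         ≡⟨ ≡.cong (λ e → q ^ (suc j C 2) * q⁻¹ ^ e) (ℕ.*-suc j n) ⟩
    q ^ (suc j C 2) * q⁻¹ ^ (j +ℕ j *ℕ n)        ≈⟨ *-congˡ (^-homo-* q⁻¹ j (j *ℕ n)) ⟩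
    q ^ (suc j C 2) * (q⁻¹ ^ j * q⁻¹ ^ (j *ℕ n)) ≈⟨ x∙yz≈y∙xz _ _ _ ⟩
    q⁻¹ ^ j * weight n j                         ≈⟨ *-comm _ _ ⟩
    weight n j * q⁻¹ ^ j                         ∎

  coeff-suc : ∀ {n j} → j ≤ n → coeff (suc n) j ≈ coeff n j * (qFactor (n +ℕ j) * (qFactor (n ∸ j) ⁻¹ * q⁻¹ ^ j))
  coeff-suc {n} {j} j≤n = begin
    S * qbinom (suc n) j * qbinom (suc n +ℕ j) j * weight (suc n) j
      ≈⟨ *-cong (*-cong (*-congˡ (qbinom-suc j≤n)) (qbinom-suc (ℕ.m≤n+m j n))) (weight-suc n j) ⟩
    S * (B₁ * (gn ÷ gk)) * (B₂ * (gnj ÷ qFactor (n +ℕ j ∸ j))) * (W * q⁻¹ ^ j)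
      ≡⟨ ≡.cong (λ i → S * (B₁ * (gn ÷ gk)) * (B₂ * (gnj ÷ qFactor i)) * (W * q⁻¹ ^ j)) (ℕ.m+n∸n≡m n j) ⟩
    S * (B₁ * (gn ÷ gk)) * (B₂ * (gnj ÷ gn)) * (W * q⁻¹ ^ j)
      ≈⟨ solve 9 (λ S B₁ B₂ W gn gn⁻¹ gk⁻¹ gnj w →
                     S :* (B₁ :* (gn :* gk⁻¹)) :* (B₂ :* (gnj :* gn⁻¹)) :* (W :* w)
                     := (S :* B₁ :* B₂ :* W) :* (gnj :* (gk⁻¹ :* w)) :* (gn :* gn⁻¹))
                 refl S B₁ B₂ W gn (gn ⁻¹) (gk ⁻¹) gnj (q⁻¹ ^ j) ⟩
    coeff n j * (gnj * (gk ⁻¹ * q⁻¹ ^ j)) * (gn * gn ⁻¹)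
      ≈⟨ *-congˡ (inverseʳ (qFactor≉0 n)) ⟩
    coeff n j * (gnj * (gk ⁻¹ * q⁻¹ ^ j)) * 1#
      ≈⟨ *-identityʳ _ ⟩
    coeff n j * (gnj * (gk ⁻¹ * q⁻¹ ^ j)) ∎
    where
      S B₁ B₂ W gn gk gnj : Carrier
      S = sgn j
      B₁ = qbinom n j
      B₂ = qbinom (n +ℕ j) j
      W = weight n j
      gn = qFactor n
      gk = qFactor (n ∸ j)
      gnj = qFactor (n +ℕ j)

  q^[1+n]≈q^j*q^[n-j]*q : ∀ {n j} → j ≤ n → q ^ suc n ≈ q ^ j * (q ^ (n ∸ j) * q)
  q^[1+n]≈q^j*q^[n-j]*q {n} {j} j≤n = begin
    q * q ^ n                      ≡⟨ ≡.cong (λ i → q * q ^ i) (ℕ.m+[n∸m]≡n j≤n) ⟨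
    q * q ^ (j +ℕ (n ∸ j))         ≈⟨ *-congˡ (^-homo-* q j (n ∸ j)) ⟩
    q * (q ^ j * q ^ (n ∸ j))      ≈⟨ solve 3 (λ q a b → q :* (a :* b) := a :* (b :* q)) refl q (q ^ j) (q ^ (n ∸ j)) ⟩
    q ^ j * (q ^ (n ∸ j) * q)      ∎

  q⁻¹^[1+n]*q^j≈q⁻¹^[1+n-j] : ∀ {n j} → j ≤ n → q⁻¹ ^ suc n * q ^ j ≈ q⁻¹ ^ suc (n ∸ j)
  q⁻¹^[1+n]*q^j≈q⁻¹^[1+n-j] {n} {j} j≤n = begin
    q⁻¹ ^ suc n * q ^ j                        ≡⟨ ≡.cong (λ i → q⁻¹ ^ suc i * q ^ j) (ℕ.m∸n+n≡m j≤n) ⟨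
    q⁻¹ ^ (suc (n ∸ j) +ℕ j) * q ^ j           ≈⟨ *-congʳ (^-homo-* q⁻¹ (suc (n ∸ j)) j) ⟩
    q⁻¹ ^ suc (n ∸ j) * q⁻¹ ^ j * q ^ j        ≈⟨ *-assoc _ _ _ ⟩
    q⁻¹ ^ suc (n ∸ j) * (q⁻¹ ^ j * q ^ j)      ≈⟨ *-congˡ (q⁻¹^n*q^n≈1 j) ⟩
    q⁻¹ ^ suc (n ∸ j) * 1#                     ≈⟨ *-identityʳ _ ⟩
    q⁻¹ ^ suc (n ∸ j)                          ∎

  qFactor[n+j]≈1-q^[1+n]*q^j : ∀ n j → qFactor (n +ℕ j) ≈ 1# - q ^ suc n * q ^ j
  qFactor[n+j]≈1-q^[1+n]*q^j n j = +-congˡ (-‿cong (begin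
    q ^ (n +ℕ j) * q               ≈⟨ *-congʳ (^-homo-* q n j) ⟩
    q ^ n * q ^ j * q              ≈⟨ solve 3 (λ a b q → a :* b :* q := (q :* a) :* b) refl (q ^ n) (q ^ j) q ⟩
    q ^ suc n * q ^ j              ∎))

  [q^j-q^[1+n]]*d≈1 : ∀ {n j} → j ≤ n → (q ^ j - q ^ suc n) * (qFactor (n ∸ j) ⁻¹ * q⁻¹ ^ j) ≈ 1#
  [q^j-q^[1+n]]*d≈1 {n} {j} j≤n = begin
    (q ^ j - q ^ suc n) * (gk ⁻¹ * q⁻¹ ^ j)             ≈⟨ *-congʳ (+-congˡ (-‿cong (q^[1+n]≈q^j*q^[n-j]*q j≤n))) ⟩
    (q ^ j - q ^ j * (q ^ k * q)) * (gk ⁻¹ * q⁻¹ ^ j)   ≈⟨ solve 4 (λ u r g w → (u :- u :* r) :* (g :* w) := (u :* w) :* ((:1 :- r) :* g))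
                                                             refl (q ^ j) (q ^ k * q) (gk ⁻¹) (q⁻¹ ^ j) ⟩
    (q ^ j * q⁻¹ ^ j) * (gk * gk ⁻¹)                    ≈⟨ *-cong (q^n*q⁻¹^n≈1 j) (inverseʳ (qFactor≉0 k)) ⟩
    1# * 1#                                             ≈⟨ *-identityˡ 1# ⟩
    1#                                                  ∎
    where
      k : ℕ
      k = n ∸ j
      gk : Carrier
      gk = qFactor k

  term : ℕ → Carrier → ℕ → Carrier
  term n x j = coeff n j ÷ (1# - x * q ^ j)

  AvoidsPoles : ℕ → Carrier → Set ℓ
  AvoidsPoles n x = ∀ j → j ≤ n → ¬ 1# - x * q ^ j ≈ 0#

  q⁻¹^[1+n]-avoidsPoles : ∀ n → AvoidsPoles n (q⁻¹ ^ suc n)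
  q⁻¹^[1+n]-avoidsPoles n j j≤n = 1-q⁻¹^[1+k]≉0 (n ∸ j) ∘ trans (+-congˡ (-‿cong (sym (q⁻¹^[1+n]*q^j≈q⁻¹^[1+n-j] j≤n))))

  term-suc : ∀ {n j x} → j ≤ n → ¬ 1# - x * q ^ j ≈ 0# → ¬ 1# - x * q ^ suc n ≈ 0# →
    ((x - q ^ suc n) ÷ (1# - x * q ^ suc n)) * term n x j
      ≈ term (suc n) x j + ((q⁻¹ ^ suc n - q ^ suc n) * term n (q⁻¹ ^ suc n) j) ÷ (1# - x * q ^ suc n)
  term-suc {n} {j} {x} j≤n Du≉0 Dv≉0 = begin
    ((x - v) ÷ (1# - x * v)) * (γ ÷ (1# - x * u))
      ≈⟨ ÷-split γ Du≉0 Dv≉0 (partialFraction ud≈1 x) ⟩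
    (γ * ((1# - v * u) * d)) ÷ (1# - x * u) + (γ * ((v * v - 1#) * d)) ÷ (1# - x * v)
      ≈⟨ +-cong (*-congʳ (*-congˡ (*-congʳ (sym (qFactor[n+j]≈1-q^[1+n]*q^j n j))))) (*-congʳ (*-congˡ residue)) ⟩
    (γ * (qFactor (n +ℕ j) * d)) ÷ (1# - x * u) + (γ * ((a - v) ÷ (1# - a * u))) ÷ (1# - x * v)
      ≈⟨ +-cong (*-congʳ (sym (coeff-suc j≤n))) (*-congʳ (x∙yz≈y∙xz γ (a - v) _)) ⟩
    term (suc n) x j + ((a - v) * term n a j) ÷ (1# - x * v) ∎
    where
      u v a d γ : Carrier
      u = q ^ j
      v = q ^ suc n
      a = q⁻¹ ^ suc n
      d = qFactor (n ∸ j) ⁻¹ * q⁻¹ ^ j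
      γ = coeff n j
      ud≈1 : (u - v) * d ≈ 1#
      ud≈1 = [q^j-q^[1+n]]*d≈1 j≤n
      residue : (v * v - 1#) * d ≈ (a - v) ÷ (1# - a * u)
      residue = x≈z÷y (q⁻¹^[1+n]-avoidsPoles n j j≤n) (partialFraction-residue ud≈1 (q⁻¹^n*q^n≈1 (suc n)))

  xnPoch-q⁻¹^m : ∀ m k → xnPoch (q⁻¹ ^ m) k * qPoch q m ≈ (q⁻¹ ^ m) ^ k * qPoch q (m +ℕ k)
  xnPoch-q⁻¹^m m zero = begin
    1# * qPoch q m                ≈⟨ *-identityˡ _ ⟩
    qPoch q m                     ≡⟨ ≡.cong (qPoch q) (ℕ.+-identityʳ m) ⟨
    qPoch q (m +ℕ 0)              ≈⟨ *-identityˡ _ ⟨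
    1# * qPoch q (m +ℕ 0)         ∎
  xnPoch-q⁻¹^m m (suc k) = begin
    xnPoch b k * (b - q ^ suc k) * qPoch q m         ≈⟨ solve 3 (λ X Y Z → X :* Y :* Z := (X :* Z) :* Y) refl (xnPoch b k) (b - q ^ suc k) (qPoch q m) ⟩
    (xnPoch b k * qPoch q m) * (b - q ^ suc k)       ≈⟨ *-cong (xnPoch-q⁻¹^m m k) b-q^[1+k]≈b*qFactor[m+k] ⟩
    (b ^ k * qPoch q (m +ℕ k)) * (b * qFactor (m +ℕ k))
                                                     ≈⟨ solve 4 (λ X Y Z T → (X :* Y) :* (Z :* T) := (Z :* X) :* (Y :* T)) refl (b ^ k) (qPoch q (m +ℕ k)) b (qFactor (m +ℕ k)) ⟩
    b ^ suc k * qPoch q (suc (m +ℕ k))               ≡⟨ ≡.cong (λ i → b ^ suc k * qPoch q i) (ℕ.+-suc m k) ⟨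
    b ^ suc k * qPoch q (m +ℕ suc k)                 ∎
    where
      b : Carrier
      b = q⁻¹ ^ m
      b-q^[1+k]≈b*qFactor[m+k] : b - q ^ suc k ≈ b * qFactor (m +ℕ k)
      b-q^[1+k]≈b*qFactor[m+k] = sym (begin
        b * (1# - q ^ (m +ℕ k) * q)                  ≈⟨ *-congˡ (+-congˡ (-‿cong (*-congʳ (^-homo-* q m k)))) ⟩
        b * (1# - q ^ m * q ^ k * q)                 ≈⟨ solve 4 (λ b X Y q → b :* (:1 :- X :* Y :* q) := b :- (b :* X) :* (q :* Y)) refl b (q ^ m) (q ^ k) q ⟩
        b - (b * q ^ m) * q ^ suc k                  ≈⟨ +-congˡ (-‿cong (*-congʳ (q⁻¹^n*q^n≈1 m))) ⟩
        b - 1# * q ^ suc k                           ≈⟨ +-congˡ (-‿cong (*-identityˡ _)) ⟩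
        b - q ^ suc k                                ∎)

  qPoch-q⁻¹^k : ∀ k → qPoch (q⁻¹ ^ k) k ≈ sgn k * q⁻¹ ^ (suc k C 2) * qPoch q k
  qPoch-q⁻¹^k zero    = sym (trans (*-identityʳ _) (*-identityʳ _))
  qPoch-q⁻¹^k (suc k) = begin
    qPoch b (suc k)                                  ≈⟨ Π<-suc k (λ t → 1# - q ^ t * b) ⟩
    (1# - 1# * b) * Π< k (λ t → 1# - q ^ suc t * b)  ≈⟨ *-cong first-factor (Π<-cong k (λ t _ → +-congˡ (-‿cong (shift t)))) ⟩
    (- 1# * b * qFactor k) * qPoch (q⁻¹ ^ k) k       ≈⟨ *-congˡ (qPoch-q⁻¹^k k) ⟩
    (- 1# * b * qFactor k) * (sgn k * q⁻¹ ^ (suc k C 2) * qPoch q k)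
      ≈⟨ solve 5 (λ b g S W P → ((:- :1) :* b :* g) :* (S :* W :* P) := ((:- :1) :* S) :* (b :* W) :* (P :* g))
                 refl b (qFactor k) (sgn k) (q⁻¹ ^ (suc k C 2)) (qPoch q k) ⟩
    sgn (suc k) * (b * q⁻¹ ^ (suc k C 2)) * qPoch q (suc k)
      ≈⟨ *-congʳ (*-congˡ (^-homo-* q⁻¹ (suc k) (suc k C 2))) ⟨
    sgn (suc k) * q⁻¹ ^ (suc k +ℕ suc k C 2) * qPoch q (suc k)
      ≡⟨ ≡.cong (λ e → sgn (suc k) * q⁻¹ ^ e * qPoch q (suc k)) ([2+k]C2≡1+k+[1+k]C2 k) ⟨
    sgn (suc k) * q⁻¹ ^ (suc (suc k) C 2) * qPoch q (suc k) ∎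
    where
      b : Carrier
      b = q⁻¹ ^ suc k
      shift : ∀ t → q ^ suc t * b ≈ q ^ t * q⁻¹ ^ k
      shift t = begin
        (q * q ^ t) * (q⁻¹ * q⁻¹ ^ k)     ≈⟨ solve 4 (λ q Q w W → (q :* Q) :* (w :* W) := (Q :* W) :* (q :* w)) refl q (q ^ t) q⁻¹ (q⁻¹ ^ k) ⟩
        (q ^ t * q⁻¹ ^ k) * (q * q⁻¹)     ≈⟨ *-congˡ q*q⁻¹≈1 ⟩
        (q ^ t * q⁻¹ ^ k) * 1#            ≈⟨ *-identityʳ _ ⟩
        q ^ t * q⁻¹ ^ k                   ∎
      first-factor : 1# - 1# * b ≈ - 1# * b * qFactor k
      first-factor = sym (begin
        - 1# * (q⁻¹ * q⁻¹ ^ k) * (1# - q ^ k * q)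
          ≈⟨ solve 4 (λ w W Q q → (:- :1) :* (w :* W) :* (:1 :- Q :* q) := :1 :* (W :* Q) :* (q :* w) :- :1 :* (w :* W))
                     refl q⁻¹ (q⁻¹ ^ k) (q ^ k) q ⟩
        1# * (q⁻¹ ^ k * q ^ k) * (q * q⁻¹) - 1# * b
          ≈⟨ +-congʳ (*-cong (*-congˡ (q⁻¹^n*q^n≈1 k)) q*q⁻¹≈1) ⟩
        1# * 1# * 1# - 1# * b
          ≈⟨ +-congʳ (trans (*-identityʳ _) (*-identityʳ _)) ⟩
        1# - 1# * b ∎)

  coeff-diag : ∀ m → coeff m m * qPoch (q⁻¹ ^ m) m ≈ xnPoch (q⁻¹ ^ m) m
  coeff-diag m = *-cancelʳ (qPoch-q≉0 m) (begin
    coeff m m * qPoch (q⁻¹ ^ m) m * P                  ≈⟨ *-congʳ (*-congˡ (qPoch-q⁻¹^k m)) ⟩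
    (S * B₁ * B₂ * (Q * W)) * (S * V * P) * P
      ≈⟨ solve 7 (λ S B₁ B₂ Q W V P → (S :* B₁ :* B₂ :* (Q :* W)) :* (S :* V :* P) :* P
                                       := (S :* S) :* B₁ :* (B₂ :* (P :* P)) :* (Q :* V) :* W)
                 refl S B₁ B₂ Q W V P ⟩
    (S * S) * B₁ * (B₂ * (P * P)) * (Q * V) * W
      ≈⟨ *-congʳ (*-cong (*-cong (*-cong (sgn*sgn≈1 m) (qbinom-diag m)) B₂*P*P≈qPoch[m+m]) (q^n*q⁻¹^n≈1 (suc m C 2))) ⟩
    1# * 1# * qPoch q (m +ℕ m) * 1# * W
      ≈⟨ solve 2 (λ X W → :1 :* :1 :* X :* :1 :* W := W :* X) refl (qPoch q (m +ℕ m)) W ⟩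
    W * qPoch q (m +ℕ m)                               ≈⟨ *-congʳ (^-assocʳ q⁻¹ m m) ⟨
    (q⁻¹ ^ m) ^ m * qPoch q (m +ℕ m)                   ≈⟨ xnPoch-q⁻¹^m m m ⟨
    xnPoch (q⁻¹ ^ m) m * P                             ∎)
    where
      S B₁ B₂ Q W V P : Carrier
      S = sgn m
      B₁ = qbinom m m
      B₂ = qbinom (m +ℕ m) m
      Q = q ^ (suc m C 2)
      V = q⁻¹ ^ (suc m C 2)
      W = q⁻¹ ^ (m *ℕ m)
      P = qPoch q m
      B₂*P*P≈qPoch[m+m] : B₂ * (P * P) ≈ qPoch q (m +ℕ m)
      B₂*P*P≈qPoch[m+m] = begin
        B₂ * (P * P)                         ≡⟨ ≡.cong (λ i → B₂ * (P * qPoch q i)) (ℕ.m+n∸n≡m m m) ⟨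
        B₂ * (P * qPoch q (m +ℕ m ∸ m))      ≈⟨ qbinom-*-denominator (m +ℕ m) m ⟩
        qPoch q (m +ℕ m)                     ∎

  closedForm : ℕ → Carrier → Carrier
  closedForm n x = xnPoch x n ÷ qPoch x (suc n)

  qPoch≉0 : ∀ {n x} → AvoidsPoles n x → ¬ qPoch x (suc n) ≈ 0#
  qPoch≉0 {n} {x} avoids = Π<≉0 (suc n) _
    (λ j j<1+n → avoids j (ℕ.m<1+n⇒m≤n j<1+n) ∘ trans (+-congˡ (-‿cong (*-comm x (q ^ j)))))

  avoidsPoles-pred : ∀ {n x} → AvoidsPoles (suc n) x → AvoidsPoles n x
  avoidsPoles-pred avoids j j≤n = avoids j (ℕ.m≤n⇒m≤1+n j≤n)

  closedForm-suc : ∀ {n x} → AvoidsPoles (suc n) x →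
    closedForm (suc n) x ≈ ((x - q ^ suc n) ÷ (1# - x * q ^ suc n)) * closedForm n x
  closedForm-suc {n} {x} avoids = begin
    (X * (x - v)) * (Q * (1# - v * x)) ⁻¹             ≈⟨ *-congˡ (⁻¹-distrib-* (qPoch≉0 (avoidsPoles-pred avoids)) 1-vx≉0) ⟩
    (X * (x - v)) * (Q ⁻¹ * (1# - v * x) ⁻¹)          ≈⟨ *-congˡ (*-congˡ (⁻¹-cong (+-congˡ (-‿cong (*-comm v x))))) ⟩
    (X * (x - v)) * (Q ⁻¹ * (1# - x * v) ⁻¹)          ≈⟨ solve 4 (λ X y Q' D' → (X :* y) :* (Q' :* D') := (y :* D') :* (X :* Q')) refl X (x - v) (Q ⁻¹) ((1# - x * v) ⁻¹) ⟩
    ((x - v) ÷ (1# - x * v)) * closedForm n x         ∎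
    where
      v X Q : Carrier
      v = q ^ suc n
      X = xnPoch x n
      Q = qPoch x (suc n)
      1-vx≉0 : ¬ 1# - v * x ≈ 0#
      1-vx≉0 = avoids (suc n) ℕ.≤-refl ∘ trans (+-congˡ (-‿cong (*-comm x v)))

  closedForm-at-pole : ∀ n → (q⁻¹ ^ suc n - q ^ suc n) * closedForm n (q⁻¹ ^ suc n) ≈ coeff (suc n) (suc n)
  closedForm-at-pole n = begin
    (a - q ^ suc n) * (xnPoch a n * qPoch a (suc n) ⁻¹)   ≈⟨ solve 3 (λ y X Q' → y :* (X :* Q') := (X :* y) :* Q') refl (a - q ^ suc n) (xnPoch a n) (qPoch a (suc n) ⁻¹) ⟩
    xnPoch a (suc n) ÷ qPoch a (suc n)                    ≈⟨ x≈z÷y (qPoch≉0 (q⁻¹^[1+n]-avoidsPoles n)) (coeff-diag (suc n)) ⟨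
    coeff (suc n) (suc n)                                 ∎
    where
      a : Carrier
      a = q⁻¹ ^ suc n

  coeff-0-0 : coeff 0 0 ≈ 1#
  coeff-0-0 = begin
    1# * qbinom 0 0 * qbinom 0 0 * (1# * 1#)   ≈⟨ *-cong (*-cong (*-congˡ (qbinom-diag 0)) (qbinom-diag 0)) (*-identityˡ 1#) ⟩
    1# * 1# * 1# * 1#                          ≈⟨ solve 0 (:1 :* :1 :* :1 :* :1 := :1) refl ⟩
    1#                                         ∎

  expansion : ∀ n x → AvoidsPoles n x → Σ< (suc n) (term n x) ≈ closedForm n x
  expansion zero x _ = begin
    0# + coeff 0 0 ÷ (1# - x * 1#)    ≈⟨ +-identityˡ _ ⟩
    coeff 0 0 ÷ (1# - x * 1#)         ≈⟨ *-cong coeff-0-0 (⁻¹-cong (solve 1 (λ x → :1 :- x :* :1 := :1 :* (:1 :- :1 :* x)) refl x)) ⟩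
    closedForm 0 x                    ∎
  expansion (suc n) x avoids = sym (begin
    closedForm (suc n) x                                            ≈⟨ closedForm-suc avoids ⟩
    K * closedForm n x                                              ≈⟨ *-congˡ (expansion n x (avoidsPoles-pred avoids)) ⟨
    K * Σ< (suc n) (term n x)                                       ≈⟨ Σ<-*ˡ (suc n) K (term n x) ⟨
    Σ< (suc n) (λ j → K * term n x j)                               ≈⟨ Σ<-cong (suc n) (λ j j<1+n → term-suc (ℕ.m<1+n⇒m≤n j<1+n) (avoids j (ℕ.<⇒≤ j<1+n)) Dv≉0) ⟩
    Σ< (suc n) (λ j → term (suc n) x j + ((a - v) * term n a j) ÷ Dv)
                                                                    ≈⟨ Σ<-+ (suc n) (term (suc n) x) _ ⟩
    Σ< (suc n) (term (suc n) x) + Σ< (suc n) (λ j → ((a - v) * term n a j) ÷ Dv)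
                                                                    ≈⟨ +-congˡ (Σ<-*ʳ (suc n) (Dv ⁻¹) _) ⟩
    Σ< (suc n) (term (suc n) x) + Σ< (suc n) (λ j → (a - v) * term n a j) ÷ Dv
                                                                    ≈⟨ +-congˡ (*-congʳ (Σ<-*ˡ (suc n) (a - v) (term n a))) ⟩
    Σ< (suc n) (term (suc n) x) + ((a - v) * Σ< (suc n) (term n a)) ÷ Dv
                                                                    ≈⟨ +-congˡ (*-congʳ (*-congˡ (expansion n a (q⁻¹^[1+n]-avoidsPoles n)))) ⟩
    Σ< (suc n) (term (suc n) x) + ((a - v) * closedForm n a) ÷ Dv   ≈⟨ +-congˡ (*-congʳ (closedForm-at-pole n)) ⟩
    Σ< (suc (suc n)) (term (suc n) x)                               ∎)
    where
      v a Dv K : Carrier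
      v = q ^ suc n
      a = q⁻¹ ^ suc n
      Dv = 1# - x * v
      K = (x - v) ÷ Dv
      Dv≉0 : ¬ Dv ≈ 0#
      Dv≉0 = avoids (suc n) ℕ.≤-refl

  partialFractionExpansion : ∀ n x → AvoidsPoles n x →
    Σ< (suc n) (λ j → sgn j * qbinom n j * qbinom (n +ℕ j) j * (weight n j ÷ (1# - x * q ^ j))) ≈ closedForm n x
  partialFractionExpansion n x avoids = trans (Σ<-cong (suc n) (λ j _ → sym (*-assoc _ _ _))) (expansion n x avoids)

  partialFractionExpansion-q^l : ∀ n l → 1 ≤ l → l ≤ n →
    Σ< (suc n) (λ j → sgn j * qbinom n j * qbinom (n +ℕ j) j * (weight n j ÷ (1# - q ^ (j +ℕ l)))) ≈ 0#
  partialFractionExpansion-q^l n (suc l) (s≤s z≤n) l<n = begin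
    Σ< (suc n) (λ j → sgn j * qbinom n j * qbinom (n +ℕ j) j * (weight n j ÷ (1# - q ^ (j +ℕ suc l))))
      ≈⟨ Σ<-cong (suc n) (λ j _ → *-congˡ (*-congˡ (⁻¹-cong (+-congˡ (-‿cong (q^[j+1+l]≈x*q^j j)))))) ⟩
    Σ< (suc n) (λ j → sgn j * qbinom n j * qbinom (n +ℕ j) j * (weight n j ÷ (1# - x * q ^ j)))
      ≈⟨ partialFractionExpansion n x avoids ⟩
    xnPoch x n ÷ qPoch x (suc n)
      ≈⟨ *-congʳ (Π<≈0 n (λ t → x - q ^ suc t) l l<n (-‿inverseʳ x)) ⟩
    0# ÷ qPoch x (suc n)
      ≈⟨ zeroˡ _ ⟩
    0# ∎
    where
      x : Carrier
      x = q ^ suc l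
      q^[j+1+l]≈x*q^j : ∀ j → q ^ (j +ℕ suc l) ≈ x * q ^ j
      q^[j+1+l]≈x*q^j j = trans (^-homo-* q j (suc l)) (*-comm _ _)
      avoids : AvoidsPoles n x
      avoids j _ = 1-q^[1+k]≉0 (l +ℕ j) ∘ trans (+-congˡ (-‿cong (^-homo-* q (suc l) j)))

  partialFractionExpansion-0 : ∀ n →
    Σ< (suc n) (λ j → sgn (n ∸ j) * qbinom n j * qbinom (n +ℕ j) j * weight n j) ≈ q ^ (suc n C 2)
  partialFractionExpansion-0 n = begin
    Σ< (suc n) (λ j → sgn (n ∸ j) * qbinom n j * qbinom (n +ℕ j) j * weight n j)
      ≈⟨ Σ<-cong (suc n) (λ j j<1+n → summand≈ j (ℕ.m<1+n⇒m≤n j<1+n)) ⟩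
    Σ< (suc n) (λ j → sgn n * term n 0# j)       ≈⟨ Σ<-*ˡ (suc n) (sgn n) (term n 0#) ⟩
    sgn n * Σ< (suc n) (term n 0#)               ≈⟨ *-congˡ (expansion n 0# (λ j _ → 1≉0 ∘ trans (sym (1-0*x≈1 (q ^ j))))) ⟩
    sgn n * (xnPoch 0# n ÷ qPoch 0# (suc n))     ≈⟨ *-congˡ (*-cong (xnPoch-0 n) (trans (⁻¹-cong qPoch-0) 1⁻¹≈1)) ⟩
    sgn n * (sgn n * q ^ (suc n C 2) * 1#)       ≈⟨ solve 2 (λ S Q → S :* (S :* Q :* :1) := (S :* S) :* Q) refl (sgn n) (q ^ (suc n C 2)) ⟩
    sgn n * sgn n * q ^ (suc n C 2)              ≈⟨ *-congʳ (sgn*sgn≈1 n) ⟩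
    1# * q ^ (suc n C 2)                         ≈⟨ *-identityˡ _ ⟩
    q ^ (suc n C 2)                              ∎
    where
      1-0*x≈1 : ∀ x → 1# - 0# * x ≈ 1#
      1-0*x≈1 x = solve 1 (λ x → :1 :- :0 :* x := :1) refl x
      xnPoch-0 : ∀ k → xnPoch 0# k ≈ sgn k * q ^ (suc k C 2)
      xnPoch-0 zero    = sym (*-identityˡ _)
      xnPoch-0 (suc k) = begin
        xnPoch 0# k * (0# - q ^ suc k)                    ≈⟨ *-congʳ (xnPoch-0 k) ⟩
        sgn k * q ^ (suc k C 2) * (0# - q ^ suc k)        ≈⟨ solve 3 (λ S Q P → S :* Q :* (:0 :- P) := (:- :1 :* S) :* (P :* Q)) refl (sgn k) (q ^ (suc k C 2)) (q ^ suc k) ⟩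
        sgn (suc k) * (q ^ suc k * q ^ (suc k C 2))       ≈⟨ *-congˡ (^-homo-* q (suc k) (suc k C 2)) ⟨
        sgn (suc k) * q ^ (suc k +ℕ suc k C 2)            ≡⟨ ≡.cong (λ e → sgn (suc k) * q ^ e) ([2+k]C2≡1+k+[1+k]C2 k) ⟨
        sgn (suc k) * q ^ (suc (suc k) C 2)               ∎
      qPoch-0 : qPoch 0# (suc n) ≈ 1#
      qPoch-0 = Π<≈1 (suc n) _ (λ t _ → trans (+-congˡ (-‿cong (*-comm _ _))) (1-0*x≈1 (q ^ t)))
      summand≈ : ∀ j → j ≤ n → sgn (n ∸ j) * qbinom n j * qbinom (n +ℕ j) j * weight n j ≈ sgn n * term n 0# j
      summand≈ j j≤n = begin
        sgn (n ∸ j) * B₁ * B₂ * W                  ≈⟨ *-congʳ (*-congʳ (*-congʳ (sgn-∸ j≤n))) ⟩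
        sgn n * sgn j * B₁ * B₂ * W                ≈⟨ solve 5 (λ S Sj B₁ B₂ W → S :* Sj :* B₁ :* B₂ :* W := S :* ((Sj :* B₁ :* B₂ :* W) :* :1)) refl (sgn n) (sgn j) B₁ B₂ W ⟩
        sgn n * (coeff n j * 1#)                   ≈⟨ *-congˡ (*-congˡ (trans (⁻¹-cong (1-0*x≈1 (q ^ j))) 1⁻¹≈1)) ⟨
        sgn n * term n 0# j                        ∎
        where
          B₁ B₂ W : Carrier
          B₁ = qbinom n j
          B₂ = qbinom (n +ℕ j) j
          W = weight n j

  centralQBinomial-identity : ∀ n l → 1 ≤ l → l ≤ n →
    Σ< n (λ j → sgn (n +ℕ 1 +ℕ j) * qbinom n j * qbinom (n +ℕ j) j
                 * ((1# - q ^ (n +ℕ l)) ÷ (1# - q ^ (j +ℕ l)))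
                 * (q ^ (suc j C 2 +ℕ n *ℕ n) * q⁻¹ ^ (j *ℕ n)))
      ≈ qbinom (2 *ℕ n) n * q ^ (suc n C 2)
  centralQBinomial-identity n l@(suc k) 1≤l@(s≤s z≤n) l≤n = begin
    Σ< n _                     ≈⟨ Σ<-cong n (λ j _ → summand≈ j) ⟩
    Σ< n (λ j → K * T j)       ≈⟨ Σ<-*ˡ n K T ⟩
    K * Σ< n T                 ≈⟨ *-congˡ (+-inverseˡ-unique _ _ (partialFractionExpansion-q^l n l 1≤l l≤n)) ⟩
    K * (- T n)                ≈⟨ *-congʳ (*-congʳ (*-congʳ (sgn-+ n 1))) ⟩
    sgn n * sgn 1 * L * Q² * (- (sgn n * B₁ * B₂ * (Q * W ÷ L)))
      ≈⟨ solve 8 (λ S L Q² B₁ B₂ Q W L⁻¹ → S :* (:- :1 :* :1) :* L :* Q² :* (:- (S :* B₁ :* B₂ :* (Q :* W :* L⁻¹)))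
                                          := (S :* S) :* B₁ :* (Q² :* W) :* (L :* L⁻¹) :* (B₂ :* Q))
                 refl (sgn n) L Q² B₁ B₂ Q W (L ⁻¹) ⟩
    (sgn n * sgn n) * B₁ * (Q² * W) * (L * L ⁻¹) * (B₂ * Q)
      ≈⟨ *-congʳ (*-cong (*-cong (*-cong (sgn*sgn≈1 n) (qbinom-diag n)) (q^n*q⁻¹^n≈1 (n *ℕ n))) (inverseʳ L≉0)) ⟩
    1# * 1# * 1# * 1# * (B₂ * Q)
      ≈⟨ solve 1 (λ X → :1 :* :1 :* :1 :* :1 :* X := X) refl (B₂ * Q) ⟩
    B₂ * Q                     ≡⟨ ≡.cong (λ i → qbinom (n +ℕ i) n * Q) (ℕ.+-identityʳ n) ⟨
    qbinom (2 *ℕ n) n * Q      ∎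
    where
      open import Algebra.Properties.Ring ring using (+-inverseˡ-unique)
      L Q Q² W B₁ B₂ K : Carrier
      L = 1# - q ^ (n +ℕ l)
      Q = q ^ (suc n C 2)
      Q² = q ^ (n *ℕ n)
      W = q⁻¹ ^ (n *ℕ n)
      B₁ = qbinom n n
      B₂ = qbinom (n +ℕ n) n
      K = sgn (n +ℕ 1) * L * Q²
      T : ℕ → Carrier
      T j = sgn j * qbinom n j * qbinom (n +ℕ j) j * (weight n j ÷ (1# - q ^ (j +ℕ l)))
      summand≈ : ∀ j → sgn (n +ℕ 1 +ℕ j) * qbinom n j * qbinom (n +ℕ j) j
                         * ((1# - q ^ (n +ℕ l)) ÷ (1# - q ^ (j +ℕ l)))
                         * (q ^ (suc j C 2 +ℕ n *ℕ n) * q⁻¹ ^ (j *ℕ n))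
                       ≈ K * T j
      summand≈ j = begin
        sgn (n +ℕ 1 +ℕ j) * C₁ * C₂ * (L ÷ D) * (q ^ (suc j C 2 +ℕ n *ℕ n) * V)
          ≈⟨ *-cong (*-congʳ (*-congʳ (*-congʳ (sgn-+ (n +ℕ 1) j)))) (*-congʳ (^-homo-* q (suc j C 2) (n *ℕ n))) ⟩
        sgn (n +ℕ 1) * sgn j * C₁ * C₂ * (L ÷ D) * (q ^ (suc j C 2) * Q² * V)
          ≈⟨ solve 9 (λ S₁ Sj C₁ C₂ L D⁻¹ P Q² V → S₁ :* Sj :* C₁ :* C₂ :* (L :* D⁻¹) :* (P :* Q² :* V)
                                                  := (S₁ :* L :* Q²) :* (Sj :* C₁ :* C₂ :* (P :* V :* D⁻¹)))
                     refl (sgn (n +ℕ 1)) (sgn j) C₁ C₂ L (D ⁻¹) (q ^ (suc j C 2)) Q² V ⟩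
        K * T j ∎
        where
          C₁ C₂ D V : Carrier
          C₁ = qbinom n j
          C₂ = qbinom (n +ℕ j) j
          D = 1# - q ^ (j +ℕ l)
          V = q⁻¹ ^ (j *ℕ n)
      L≉0 : ¬ L ≈ 0#
      L≉0 = 1-q^[1+k]≉0 (n +ℕ k) ∘ trans (+-congˡ (-‿cong (reflexive (≡.cong (q ^_) (≡.sym (ℕ.+-suc n k))))))

mainTheorem16 : ∀ {c ℓ : Level} (F : Field c ℓ) →
    let open Field F in
    let open FieldOps F in
    CharZero → (q : Carrier) → NotRootOfUnity q →
    let open QSeries F q in
    (n : ℕ) → 1 ≤ n →
      ((x : Carrier) → (∀ j → j ≤ n → ¬ ((1# - x * q ^ j) ≈ 0#)) →
        Σ< (suc n) (λ j → sgn j * qbinom n j * qbinom (n +ℕ j) j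
                     * ((q ^ (suc j C 2) * (q ⁻¹) ^ (j *ℕ n)) ÷ (1# - x * q ^ j)))
        ≈ (xnPoch x n ÷ qPoch x (suc n)))
      × (∀ l → 1 ≤ l → l ≤ n →
        Σ< (suc n) (λ j → sgn j * qbinom n j * qbinom (n +ℕ j) j
                     * ((q ^ (suc j C 2) * (q ⁻¹) ^ (j *ℕ n)) ÷ (1# - q ^ (j +ℕ l))))
        ≈ 0#)
      × (∀ l → 1 ≤ l → l ≤ n →
        Σ< n (λ j → sgn (n +ℕ 1 +ℕ j) * qbinom n j * qbinom (n +ℕ j) j
                     * ((1# - q ^ (n +ℕ l)) ÷ (1# - q ^ (j +ℕ l)))
                     * (q ^ (suc j C 2 +ℕ n *ℕ n) * (q ⁻¹) ^ (j *ℕ n)))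
        ≈ (qbinom (2 *ℕ n) n * q ^ (suc n C 2)))
      × (q ^ (suc n C 2)
        ≈ Σ< (suc n) (λ j → sgn (n ∸ j) * qbinom n j * qbinom (n +ℕ j) j
                     * (q ^ (suc j C 2) * (q ⁻¹) ^ (j *ℕ n))))
mainTheorem16 F _ q q-generic n _ =
    partialFractionExpansion n
  , partialFractionExpansion-q^l n
  , centralQBinomial-identity n
  , sym (partialFractionExpansion-0 n)
  where
    open Field F using (sym)
    open QPartialFractions F q q-generic
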